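{- For $n\ge1$ let $Q_n$ be a uniformly random Stirling permutation of length $2n$, and let $X_n$, $Y_n$, $Z_n$ denote respectively the numbers of ascents, descents and plateaux of $Q_n$. Then for every $n\ge 1$, \[ \operatorname{Cov}(X_n,Y_n)=\operatorname{Cov}(X_n,Z_n)=\operatorname{Cov}(Y_n,Z_n)=-\frac{n^2-1}{9(2n-1)}. \]
   Context: A Stirling permutation of length $2n$ is a permutation (word) $a_1a_2\cdots a_{2n}$ of the multiset $\{1,1,2,2,\dots,n,n\}$ such that for each $i\le n$, all elements occurring between the two occurrences of $i$ are larger than $i$. A uniformly random Stirling permutation is a uniformly random element of the finite set of all Stirling permutations of length $2n$. Set $a_0=a_{2n+1}=0$. An index $i\in\{0,1,\dots,2n\}$ is an ascent if $a_i<a_{i+1}$, a descent if $a_i>a_{i+1}$, and a plateau if $a_i=a_{i+1}$. -}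

module Defs where

open import Data.Nat using (ℕ; zero; suc; _+_; _∸_; _<_; _≤_; NonZero)
open import Data.Nat.Properties using (_<?_; _≟_)
open import Data.Fin using (Fin; toℕ)
open import Data.List using (List; []; _∷_; _++_; length; map; concatMap; upTo; lookup)
open import Data.List.Relation.Binary.Permutation.Propositional using (_↭_)
open import Data.Integer using (+_)
open import Data.Nat.ListAction using (sum)
import Data.Nat
open import Data.Rational using (ℚ; _/_; _-_; _*_; -_; 0ℚ)
open import Relation.Binary.PropositionalEquality using (_≡_)
open import Relation.Nullary.Decidable using (⌊_⌋)
open import Data.Bool using (Bool; if_then_else_)

doubled : ℕ → List ℕ
doubled n = concatMap (λ i → suc i ∷ suc i ∷ []) (upTo n)

record IsStirling (n : ℕ) (w : List ℕ) : Set where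
  field
    isPerm   : w ↭ doubled n
    stirling : (p q r : Fin (length w)) → toℕ p < toℕ q → toℕ q < toℕ r →
               lookup w p ≡ lookup w r → lookup w p < lookup w q

countFrom : (ℕ → ℕ → Bool) → ℕ → List ℕ → ℕ
countFrom P x [] = 0
countFrom P x (y ∷ ys) = (if P x y then 1 else 0) + countFrom P y ys

countPairs : (ℕ → ℕ → Bool) → List ℕ → ℕ
countPairs P [] = 0
countPairs P (x ∷ xs) = countFrom P x xs

isAsc isDes isPlat : ℕ → ℕ → Bool
isAsc x y  = ⌊ x <? y ⌋
isDes x y  = ⌊ y <? x ⌋
isPlat x y = ⌊ x ≟ y ⌋

-- Pad with a_0 = a_{2n+1} = 0; indices i ∈ {0,...,2n} compare a_i with a_{i+1}.
padded : List ℕ → List ℕ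
padded w = 0 ∷ (w ++ (0 ∷ []))

ascents descents plateaux : List ℕ → ℕ
ascents w  = countPairs isAsc (padded w)
descents w = countPairs isDes (padded w)
plateaux w = countPairs isPlat (padded w)

-- Expectation of f under the uniform distribution on the entries of L
-- (L will be a duplicate-free enumeration of a finite nonempty set).
mean : {A : Set} → List A → (A → ℕ) → ℚ
mean [] f = 0ℚ
mean L@(_ ∷ _) f = (+ sum (map f L)) / length L

Cov : {A : Set} → List A → (A → ℕ) → (A → ℕ) → ℚ
Cov L f g = mean L (λ a → f a Data.Nat.* g a) - (mean L f * mean L g)

covValue : ℕ → ℚ
covValue zero = 0ℚ
covValue n@(suc m) = - ((+ (n Data.Nat.* n ∸ 1)) / (9 Data.Nat.* (suc (m + m))))

-- Every Stirling permutation of order k + 1 arises exactly once by inserting the block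
-- (k+1)(k+1) into one of the 2k + 1 gaps of a Stirling permutation of order k, the gaps being
-- the steps of the word padded with 0 on both sides. Inserting into an ascent, descent or
-- plateau replaces that step by an ascent, a plateau and a descent, so Σ F(X, Y, Z) over order
-- k + 1 is the sum over order k of X F(X, Y+1, Z+1) + Y F(X+1, Y, Z+1) + Z F(X+1, Y+1, Z).
-- This recursion is symmetric in the three statistics, as is the single permutation 1 1 of
-- order 1, so from order 1 on all such sums are invariant under permuting (X, Y, Z). Since
-- X + Y + Z = 2n + 1, E X = (2n + 1)/3, and the recursion for Σ X Y gives
-- 9 (2n − 1) E[X Y] = n (8n² + 3n − 2), whence the covariance.

module Submission where

open import Defs
open import Data.Bool using (Bool; true; false; if_then_else_)
open import Data.Empty using (⊥-elim)
open import Data.Fin using (Fin; toℕ; fromℕ<)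
import Data.Fin as Fin
open import Data.Fin.Properties using (toℕ<n; toℕ-fromℕ<)
open import Data.Integer using (ℤ; +_; -_)
import Data.Integer as ℤ
import Data.Integer.Properties as ℤ
import Data.Integer.Tactic.RingSolver as ℤ-Solver
open import Data.List using (List; []; _∷_; _++_; length; map; concatMap; filter; upTo; lookup)
open import Data.List.Properties
  using (length-++; map-++; map-∘; map-cong; map-cong-local; concatMap-++; upTo-∷ʳ;
         ∷-injectiveˡ; ∷-injectiveʳ; filter-++; filter-all; filter-reject)
open import Data.List.Membership.Propositional using (_∈_; _∉_; find; lose)
open import Data.List.Membership.Propositional.Properties
  using (∈-map⁻; ∈-map⁺; ∈-++⁻; ∈-++⁺ʳ; ∈-∃++; ∈-concatMap⁺; ∈-concatMap⁻)
open import Data.List.Membership.Propositional.Properties.WithK using (unique∧set⇒bag)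
open import Data.List.Relation.Binary.BagAndSetEquality using (∼bag⇒↭)
open import Data.List.Relation.Binary.Permutation.Propositional using (_↭_; ↭-sym; ↭-trans; prep; ↭-refl)
open import Data.List.Relation.Binary.Permutation.Propositional.Properties
  using (shift; shifts; drop-∷; ++-comm; All-resp-↭; ∈-resp-↭; ↭-empty-inv; ↭-length)
import Data.List.Relation.Binary.Permutation.Propositional.Properties as ↭
open import Data.List.Relation.Unary.All using (All; []; _∷_)
import Data.List.Relation.Unary.All as All
import Data.List.Relation.Unary.All.Properties as All
open import Data.List.Relation.Unary.Any using (here; there)
open import Data.List.Relation.Unary.Unique.Propositional using (Unique; []; _∷_)
import Data.List.Relation.Unary.Unique.Propositional.Properties as Unique
open import Data.Nat using (ℕ; zero; suc; pred; _+_; _*_; _∸_; _<_; _≤_; z≤n; s≤s)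
open import Data.Nat.Properties
open import Algebra.Properties.CommutativeSemigroup +-commutativeSemigroup using (interchange; xy∙z≈yx∙z; xy∙z≈xz∙y)
open import Data.Nat.ListAction using (sum)
open import Data.Nat.ListAction.Properties using (sum-++; sum-↭)
open import Data.Nat.Tactic.RingSolver using (solve-∀)
open import Data.Product using (_×_; _,_; ∃; ∃₂)
import Data.Rational as ℚ
open import Data.Rational using (_/_; toℚᵘ)
open import Data.Rational.Properties using (toℚᵘ-injective; toℚᵘ-homo-+; toℚᵘ-homo-*; toℚᵘ-homo‿-; toℚᵘ-fromℚᵘ)
open import Data.Rational.Unnormalised using (mkℚᵘ; *≡*)
import Data.Rational.Unnormalised as ℚᵘ
import Data.Rational.Unnormalised.Properties as ℚᵘ
open import Data.Sum using (inj₁; inj₂)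
open import Function using (_∘_)
open import Function.Bundles using (_⇔_; mk⇔)
open import Function.Construct.Composition using (_⇔-∘_)
open import Function.Construct.Symmetry using (⇔-sym)
open import Relation.Binary.Definitions using (tri<; tri≈; tri>)
open import Relation.Binary.PropositionalEquality
open import Relation.Nullary using (Dec; ¬_; ¬?; yes; no)
open import Relation.Nullary.Decidable using (⌊_⌋; isYes≗does; dec-true; dec-false)

insertions : ℕ → List ℕ → List (List ℕ)
insertions a [] = (a ∷ a ∷ []) ∷ []
insertions a (b ∷ w) = (a ∷ a ∷ b ∷ w) ∷ map (b ∷_) (insertions a w)

stirlings : ℕ → List (List ℕ)
stirlings zero = [] ∷ []
stirlings (suc k) = concatMap (insertions (suc k)) (stirlings k)

-- Total indexing, with junk value 0 past the end.
nth : List ℕ → ℕ → ℕ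
nth [] _ = 0
nth (x ∷ xs) zero = x
nth (x ∷ xs) (suc i) = nth xs i

All-nth : ∀ {P : ℕ → Set} {w} → All P w → ∀ i → i < length w → P (nth w i)
All-nth (px ∷ _) zero _ = px
All-nth (_ ∷ pw) (suc i) (s≤s i<n) = All-nth pw i i<n

StirlingWord : List ℕ → Set
StirlingWord w = ∀ p q r → p < q → q < r → r < length w → nth w p ≡ nth w r → nth w p < nth w q

lookup≡nth : ∀ w (i : Fin (length w)) → lookup w i ≡ nth w (toℕ i)
lookup≡nth (x ∷ w) Fin.zero = refl
lookup≡nth (x ∷ w) (Fin.suc i) = lookup≡nth w i

isStirling⇒StirlingWord : ∀ {n w} → IsStirling n w → StirlingWord w
isStirling⇒StirlingWord {w = w} s p q r p<q q<r r<∣w∣ eq =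
  subst₂ _<_ (nth-at p<∣w∣) (nth-at q<∣w∣)
    (IsStirling.stirling s (fromℕ< p<∣w∣) (fromℕ< q<∣w∣) (fromℕ< r<∣w∣)
      (subst₂ _<_ (sym (toℕ-fromℕ< p<∣w∣)) (sym (toℕ-fromℕ< q<∣w∣)) p<q)
      (subst₂ _<_ (sym (toℕ-fromℕ< q<∣w∣)) (sym (toℕ-fromℕ< r<∣w∣)) q<r)
      (trans (nth-at p<∣w∣) (trans eq (sym (nth-at r<∣w∣)))))
  where
  q<∣w∣ = <-trans q<r r<∣w∣
  p<∣w∣ = <-trans p<q q<∣w∣
  nth-at : ∀ {i} (i<∣w∣ : i < length w) → lookup w (fromℕ< i<∣w∣) ≡ nth w i
  nth-at i<∣w∣ = trans (lookup≡nth w _) (cong (nth w) (toℕ-fromℕ< i<∣w∣))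

StirlingWord⇒isStirling : ∀ {n w} → w ↭ doubled n → StirlingWord w → IsStirling n w
StirlingWord⇒isStirling {w = w} perm s = record
  { isPerm = perm
  ; stirling = λ p q r p<q q<r eq →
      subst₂ _<_ (sym (lookup≡nth w p)) (sym (lookup≡nth w q))
        (s (toℕ p) (toℕ q) (toℕ r) p<q q<r (toℕ<n r)
           (trans (sym (lookup≡nth w p)) (trans eq (lookup≡nth w r))))
  }

-- skip u i is the position in u ++ a ∷ a ∷ v of the entry at position i of u ++ v.
skip : List ℕ → ℕ → ℕ
skip [] i = suc (suc i)
skip (_ ∷ u) zero = zero
skip (_ ∷ u) (suc i) = suc (skip u i)

data Position (u : List ℕ) : ℕ → Set where
  old  : ∀ j → Position u (skip u j)
  twin : ∀ {i} → length u ≤ i → i ≤ suc (length u) → Position u i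

position : ∀ u i → Position u i
position [] zero = twin z≤n z≤n
position [] (suc zero) = twin z≤n (s≤s z≤n)
position [] (suc (suc j)) = old j
position (x ∷ u) zero = old zero
position (x ∷ u) (suc i) with position u i
... | old j = old (suc j)
... | twin u≤i i≤u+1 = twin (s≤s u≤i) (s≤s i≤u+1)

skip-mono-< : ∀ u {i j} → i < j → skip u i < skip u j
skip-mono-< [] i<j = s≤s (s≤s i<j)
skip-mono-< (x ∷ u) {zero} {suc j} i<j = s≤s z≤n
skip-mono-< (x ∷ u) {suc i} {suc j} (s≤s i<j) = s≤s (skip-mono-< u i<j)

skip-cancel-< : ∀ u {i j} → skip u i < skip u j → i < j
skip-cancel-< [] (s≤s (s≤s i<j)) = i<j
skip-cancel-< (x ∷ u) {zero} {suc j} _ = s≤s z≤n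
skip-cancel-< (x ∷ u) {suc i} {suc j} (s≤s i<j) = s≤s (skip-cancel-< u i<j)

module _ (a : ℕ) where

  nth-skip : ∀ u v i → nth (u ++ a ∷ a ∷ v) (skip u i) ≡ nth (u ++ v) i
  nth-skip [] v i = refl
  nth-skip (x ∷ u) v zero = refl
  nth-skip (x ∷ u) v (suc i) = nth-skip u v i

  nth-twin : ∀ u v {i} → length u ≤ i → i ≤ suc (length u) → nth (u ++ a ∷ a ∷ v) i ≡ a
  nth-twin [] v {zero} _ _ = refl
  nth-twin [] v {suc zero} _ _ = refl
  nth-twin [] v {suc (suc i)} _ (s≤s ())
  nth-twin (x ∷ u) v {suc i} (s≤s u≤i) (s≤s i≤u+1) = nth-twin u v u≤i i≤u+1

  skip-<-length : ∀ u v {i} → i < length (u ++ v) → skip u i < length (u ++ a ∷ a ∷ v)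
  skip-<-length [] v i<n = s≤s (s≤s i<n)
  skip-<-length (x ∷ u) v {zero} _ = s≤s z≤n
  skip-<-length (x ∷ u) v {suc i} (s≤s i<n) = s≤s (skip-<-length u v i<n)

  skip-<-length⁻ : ∀ u v {i} → skip u i < length (u ++ a ∷ a ∷ v) → i < length (u ++ v)
  skip-<-length⁻ [] v (s≤s (s≤s i<n)) = i<n
  skip-<-length⁻ (x ∷ u) v {zero} _ = s≤s z≤n
  skip-<-length⁻ (x ∷ u) v {suc i} (s≤s i<n) = s≤s (skip-<-length⁻ u v i<n)

  StirlingWord-remove : ∀ u v → StirlingWord (u ++ a ∷ a ∷ v) → StirlingWord (u ++ v)
  StirlingWord-remove u v s p q r p<q q<r r<n eq =
    subst₂ _<_ (nth-skip u v p) (nth-skip u v q)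
      (s (skip u p) (skip u q) (skip u r) (skip-mono-< u p<q) (skip-mono-< u q<r) (skip-<-length u v r<n)
         (trans (nth-skip u v p) (trans eq (sym (nth-skip u v r)))))

  twin≢old : ∀ u v → All (_< a) (u ++ v) → ∀ {i} → length u ≤ i → i ≤ suc (length u) → ∀ j → j < length (u ++ v) →
    ¬ nth (u ++ a ∷ a ∷ v) i ≡ nth (u ++ a ∷ a ∷ v) (skip u j)
  twin≢old u v u++v<a u≤i i≤u+1 j j<n eq =
    <-irrefl (trans (sym (nth-skip u v j)) (trans (sym eq) (nth-twin u v u≤i i≤u+1))) (All-nth u++v<a j j<n)

  -- The new letter a exceeds all others, so it can only be the middle entry of a pattern p < q < r.
  StirlingWord-insert : ∀ u v → All (_< a) (u ++ v) → StirlingWord (u ++ v) → StirlingWord (u ++ a ∷ a ∷ v)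
  StirlingWord-insert u v u++v<a s p q r p<q q<r r<n eq with position u p | position u r
  ... | twin u≤p _ | twin _ r≤u+1 = ⊥-elim (<⇒≱ (≤-trans (s≤s (s≤s u≤p)) (≤-trans (s≤s p<q) q<r)) r≤u+1)
  ... | twin u≤p p≤u+1 | old l = ⊥-elim (twin≢old u v u++v<a u≤p p≤u+1 l (skip-<-length⁻ u v r<n) eq)
  ... | old j | twin u≤r r≤u+1 =
        ⊥-elim (twin≢old u v u++v<a u≤r r≤u+1 j (skip-<-length⁻ u v (<-trans p<q (<-trans q<r r<n))) (sym eq))
  ... | old j | old l with position u q
  ...   | twin u≤q q≤u+1 = subst₂ _<_ (sym (nth-skip u v j)) (sym (nth-twin u v u≤q q≤u+1))
                            (All-nth u++v<a j (<-trans (skip-cancel-< u (<-trans p<q q<r)) (skip-<-length⁻ u v r<n)))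
  ...   | old k = subst₂ _<_ (sym (nth-skip u v j)) (sym (nth-skip u v k))
                   (s j k l (skip-cancel-< u p<q) (skip-cancel-< u q<r) (skip-<-length⁻ u v r<n)
                      (trans (sym (nth-skip u v j)) (trans eq (nth-skip u v l))))

nth-++ʳ : ∀ u xs i → nth (u ++ xs) (length u + i) ≡ nth xs i
nth-++ʳ [] xs i = refl
nth-++ʳ (x ∷ u) xs i = nth-++ʳ u xs i

StirlingWord-max-adjacent : ∀ {a b} u v v' → StirlingWord (u ++ a ∷ b ∷ v ++ a ∷ v') → ¬ b ≤ a
StirlingWord-max-adjacent {a} {b} u v v' s b≤a = <⇒≱ a<b b≤a
  where
  xs = a ∷ b ∷ v ++ a ∷ v'
  r = suc (suc (length v))
  second-a : nth xs r ≡ a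
  second-a = trans (cong (nth (v ++ a ∷ v')) (sym (+-identityʳ (length v)))) (nth-++ʳ v (a ∷ v') 0)
  r<n : length u + r < length (u ++ xs)
  r<n = subst (length u + r <_) (sym (length-++ u))
          (+-monoʳ-< (length u) (s≤s (s≤s (subst (length v <_) (sym (length-++ v)) (m<m+n (length v) (s≤s z≤n))))))
  a<b : a < b
  a<b = subst₂ _<_ (nth-++ʳ u xs 0) (nth-++ʳ u xs 1)
          (s (length u + 0) (length u + 1) (length u + r)
             (+-monoʳ-< (length u) (s≤s z≤n)) (+-monoʳ-< (length u) (s≤s (s≤s z≤n))) r<n
             (trans (nth-++ʳ u xs 0) (sym (trans (nth-++ʳ u xs r) second-a))))

doubled-suc : ∀ k → doubled (suc k) ≡ doubled k ++ suc k ∷ suc k ∷ []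
doubled-suc k = trans (cong (concatMap (λ i → suc i ∷ suc i ∷ [])) (sym (upTo-∷ʳ k)))
                      (concatMap-++ (λ i → suc i ∷ suc i ∷ []) (upTo k) (k ∷ []))

doubled-suc-↭ : ∀ k → doubled (suc k) ↭ suc k ∷ suc k ∷ doubled k
doubled-suc-↭ k rewrite doubled-suc k = ++-comm (doubled k) (suc k ∷ suc k ∷ [])

doubled-≤ : ∀ k → All (_≤ k) (doubled k)
doubled-≤ zero = []
doubled-≤ (suc k) rewrite doubled-suc k = All.++⁺ (All.map m≤n⇒m≤1+n (doubled-≤ k)) (≤-refl ∷ ≤-refl ∷ [])

length-doubled : ∀ k → length (doubled k) ≡ k + k
length-doubled zero = refl
length-doubled (suc k) = begin
  length (doubled (suc k))                  ≡⟨ cong length (doubled-suc k) ⟩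
  length (doubled k ++ suc k ∷ suc k ∷ [])  ≡⟨ length-++ (doubled k) ⟩
  length (doubled k) + 2                    ≡⟨ cong (_+ 2) (length-doubled k) ⟩
  k + k + 2                                 ≡⟨ +-comm (k + k) 2 ⟩
  suc (suc (k + k))                         ≡⟨ cong suc (+-suc k k) ⟨
  suc k + suc k                             ∎
  where open ≡-Reasoning

∈-insertions⁻ : ∀ {a c} w → c ∈ insertions a w → ∃₂ λ u v → w ≡ u ++ v × c ≡ u ++ a ∷ a ∷ v
∈-insertions⁻ [] (here refl) = [] , [] , refl , refl
∈-insertions⁻ (b ∷ w) (here refl) = [] , b ∷ w , refl , refl
∈-insertions⁻ (b ∷ w) (there c∈) with ∈-map⁻ (b ∷_) c∈
... | c' , c'∈ , refl with ∈-insertions⁻ w c'∈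
...   | u , v , refl , refl = b ∷ u , v , refl , refl

∈-insertions⁺ : ∀ a u v → u ++ a ∷ a ∷ v ∈ insertions a (u ++ v)
∈-insertions⁺ a [] [] = here refl
∈-insertions⁺ a [] (b ∷ v) = here refl
∈-insertions⁺ a (b ∷ u) v = there (∈-map⁺ (b ∷_) (∈-insertions⁺ a u v))

∈-stirlings-suc⁻ : ∀ k {c} → c ∈ stirlings (suc k) →
  ∃₂ λ u v → u ++ v ∈ stirlings k × c ≡ u ++ suc k ∷ suc k ∷ v
∈-stirlings-suc⁻ k c∈ with find (∈-concatMap⁻ (insertions (suc k)) {xs = stirlings k} c∈)
... | w , w∈ , c∈ins with ∈-insertions⁻ w c∈ins
...   | u , v , refl , c≡ = u , v , w∈ , c≡

∈-stirlings-suc⁺ : ∀ k u v → u ++ v ∈ stirlings k → u ++ suc k ∷ suc k ∷ v ∈ stirlings (suc k)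
∈-stirlings-suc⁺ k u v w∈ = ∈-concatMap⁺ (insertions (suc k)) (lose w∈ (∈-insertions⁺ (suc k) u v))

first-occurrence : ∀ {a : ℕ} w → a ∈ w → ∃₂ λ u rest → w ≡ u ++ a ∷ rest × a ∉ u
first-occurrence {a} (b ∷ w) a∈ with b ≟ a | a∈
... | yes refl | _ = [] , w , refl , λ ()
... | no b≢a | here a≡b = ⊥-elim (b≢a (sym a≡b))
... | no b≢a | there a∈w with first-occurrence w a∈w
...   | u , rest , refl , a∉u = b ∷ u , rest , refl , λ { (here a≡b) → b≢a (sym a≡b) ; (there a∈u) → a∉u a∈u }

second-occurrence : ∀ {a : ℕ} u rest {xs} → u ++ a ∷ rest ↭ a ∷ a ∷ xs → a ∉ u → a ∈ rest
second-occurrence {a} u rest perm a∉u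
  with ∈-++⁻ u (∈-resp-↭ (↭-sym (drop-∷ (↭-trans (↭-sym (shift a u rest)) perm))) (here refl))
... | inj₁ a∈u = ⊥-elim (a∉u a∈u)
... | inj₂ a∈rest = a∈rest

IsStirling-≤ : ∀ {n w} → IsStirling n w → All (_≤ n) w
IsStirling-≤ s = All-resp-↭ (↭-sym (IsStirling.isPerm s)) (doubled-≤ _)

IsStirling-↭ : ∀ {k w} → IsStirling (suc k) w → w ↭ suc k ∷ suc k ∷ doubled k
IsStirling-↭ {k} s = ↭-trans (IsStirling.isPerm s) (doubled-suc-↭ k)

stirlings-sound : ∀ n {w} → w ∈ stirlings n → IsStirling n w
stirlings-sound zero (here refl) = StirlingWord⇒isStirling ↭-refl (λ _ _ _ _ _ ())
stirlings-sound (suc k) c∈ with ∈-stirlings-suc⁻ k c∈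
... | u , v , w∈ , refl = StirlingWord⇒isStirling
        (↭-trans (shifts u (suc k ∷ suc k ∷ []))
           (↭-trans (prep (suc k) (prep (suc k) (IsStirling.isPerm s))) (↭-sym (doubled-suc-↭ k))))
        (StirlingWord-insert (suc k) u v (All.map s≤s (IsStirling-≤ s)) (isStirling⇒StirlingWord s))
  where s = stirlings-sound k w∈

twin-decomposition : ∀ k {w} → IsStirling (suc k) w → ∃₂ λ u v → w ≡ u ++ suc k ∷ suc k ∷ v
twin-decomposition k {w} s with first-occurrence w (∈-resp-↭ (↭-sym (IsStirling-↭ s)) (here refl))
... | u , rest , refl , a∉u with ∈-∃++ (second-occurrence u rest (IsStirling-↭ s) a∉u)
...   | [] , v , refl = u , v , refl
...   | b ∷ v , v' , refl = ⊥-elim (StirlingWord-max-adjacent u v v' (isStirling⇒StirlingWord s)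
                                      (All.lookup (IsStirling-≤ s) (∈-++⁺ʳ u (there (here refl)))))

stirlings-complete : ∀ n {w} → IsStirling n w → w ∈ stirlings n
stirlings-complete zero s rewrite ↭-empty-inv (IsStirling.isPerm s) = here refl
stirlings-complete (suc k) s with twin-decomposition k s
... | u , v , refl = ∈-stirlings-suc⁺ k u v (stirlings-complete k
        (StirlingWord⇒isStirling (drop-∷ (drop-∷ (↭-trans (↭-sym (shifts u (suc k ∷ suc k ∷ []))) (IsStirling-↭ s))))
                                 (StirlingWord-remove (suc k) u v (isStirling⇒StirlingWord s))))

stirlings-characterization : ∀ n {w} → w ∈ stirlings n ⇔ IsStirling n w
stirlings-characterization n = mk⇔ (stirlings-sound n) (stirlings-complete n)

stirlings-< : ∀ k {w} → w ∈ stirlings k → All (_< suc k) w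
stirlings-< k w∈ = All.map s≤s (IsStirling-≤ (stirlings-sound k w∈))

Unique-concatMap : ∀ {A B : Set} (f : A → List B) (g : B → A) {xs} →
  (∀ {x y} → x ∈ xs → y ∈ f x → g y ≡ x) → All (Unique ∘ f) xs → Unique xs → Unique (concatMap f xs)
Unique-concatMap f g g-retracts [] [] = []
Unique-concatMap f g {x ∷ xs} g-retracts (fx! ∷ fxs!) (x∉xs ∷ xs!) =
  Unique.++⁺ fx! (Unique-concatMap f g (g-retracts ∘ there) fxs! xs!) disjoint
  where
  disjoint : ∀ {y} → ¬ (y ∈ f x × y ∈ concatMap f xs)
  disjoint (y∈fx , y∈rest) with find (∈-concatMap⁻ f {xs = xs} y∈rest)
  ... | x' , x'∈xs , y∈fx' =
    All.lookup x∉xs x'∈xs (trans (sym (g-retracts (here refl) y∈fx)) (g-retracts (there x'∈xs) y∈fx'))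

≢? : (a x : ℕ) → Dec (¬ x ≡ a)
≢? a x = ¬? (x ≟ a)

erase : ℕ → List ℕ → List ℕ
erase a = filter (≢? a)

erase-insertions : ∀ {a c} w → All (_< a) w → c ∈ insertions a w → erase a c ≡ w
erase-insertions {a} w w<a c∈ with ∈-insertions⁻ w c∈
... | u , v , refl , refl = begin
  erase a (u ++ a ∷ a ∷ v)          ≡⟨ filter-++ (≢? a) u (a ∷ a ∷ v) ⟩
  erase a u ++ erase a (a ∷ a ∷ v)  ≡⟨ cong (erase a u ++_) (trans (filter-reject (≢? a) {xs = a ∷ v} (λ a≢a → a≢a refl))
                                                                    (filter-reject (≢? a) {xs = v} (λ a≢a → a≢a refl))) ⟩
  erase a u ++ erase a v            ≡⟨ filter-++ (≢? a) u v ⟨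
  erase a (u ++ v)                  ≡⟨ filter-all (≢? a) (All.map <⇒≢ w<a) ⟩
  u ++ v                            ∎
  where open ≡-Reasoning

Unique-insertions : ∀ {a} w → All (_< a) w → Unique (insertions a w)
Unique-insertions [] [] = [] ∷ []
Unique-insertions (b ∷ w) (b<a ∷ w<a) =
  All.map⁺ (All.universal (λ c aab≡bc → <-irrefl (sym (∷-injectiveˡ aab≡bc)) b<a) _)
  ∷ Unique.map⁺ ∷-injectiveʳ (Unique-insertions w w<a)

stirlings-unique : ∀ n → Unique (stirlings n)
stirlings-unique zero = [] ∷ []
stirlings-unique (suc k) =
  Unique-concatMap (insertions (suc k)) (erase (suc k))
    (λ w∈ c∈ → erase-insertions _ (stirlings-< k w∈) c∈)
    (All.tabulate (λ w∈ → Unique-insertions _ (stirlings-< k w∈)))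
    (stirlings-unique k)

↭-stirlings : ∀ n {L} → Unique L → (∀ w → w ∈ L ⇔ IsStirling n w) → L ↭ stirlings n
↭-stirlings n L! L⇔ =
  ∼bag⇒↭ (unique∧set⇒bag L! (stirlings-unique n) (λ {w} → ⇔-sym (stirlings-characterization n) ⇔-∘ L⇔ w))

⌊⌋-true : ∀ {A : Set} (a? : Dec A) → A → ⌊ a? ⌋ ≡ true
⌊⌋-true a? a = trans (isYes≗does a?) (dec-true a? a)

⌊⌋-false : ∀ {A : Set} (a? : Dec A) → ¬ A → ⌊ a? ⌋ ≡ false
⌊⌋-false a? ¬a = trans (isYes≗does a?) (dec-false a? ¬a)

indicator : Bool → ℕ
indicator b = if b then 1 else 0

data Step (p b : ℕ) : Set where
  ascent  : isAsc p b ≡ true  → isDes p b ≡ false → isPlat p b ≡ false → Step p b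
  descent : isAsc p b ≡ false → isDes p b ≡ true  → isPlat p b ≡ false → Step p b
  plateau : isAsc p b ≡ false → isDes p b ≡ false → isPlat p b ≡ true  → Step p b

step : ∀ p b → Step p b
step p b with <-cmp p b
... | tri< p<b p≢b p≯b = ascent (⌊⌋-true (p <? b) p<b) (⌊⌋-false (b <? p) p≯b) (⌊⌋-false (p ≟ b) p≢b)
... | tri≈ p≮b p≡b p≯b = plateau (⌊⌋-false (p <? b) p≮b) (⌊⌋-false (b <? p) p≯b) (⌊⌋-true (p ≟ b) p≡b)
... | tri> p≮b p≢b p>b = descent (⌊⌋-false (p <? b) p≮b) (⌊⌋-true (b <? p) p>b) (⌊⌋-false (p ≟ b) p≢b)

Weight : Set
Weight = ℕ → ℕ → ℕ → ℕ

-- F applied to (#ascents, #descents, #plateaux) of the steps of p l; a word w is weighed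
-- as weigh F 0 (w ++ 0 ∷ []), i.e. via padded w.
weigh : Weight → ℕ → List ℕ → ℕ
weigh F p l = F (countFrom isAsc p l) (countFrom isDes p l) (countFrom isPlat p l)

steps-partition : ∀ p l → countFrom isAsc p l + countFrom isDes p l + countFrom isPlat p l ≡ length l
steps-partition p [] = refl
steps-partition p (b ∷ l) with step p b
... | ascent  a d e rewrite a | d | e = cong suc (steps-partition b l)
... | descent a d e rewrite a | d | e =
  trans (cong (_+ countFrom isPlat b l) (+-suc (countFrom isAsc b l) _)) (cong suc (steps-partition b l))
... | plateau a d e rewrite a | d | e =
  trans (+-suc (countFrom isAsc b l + countFrom isDes b l) _) (cong suc (steps-partition b l))

-- Inserting a a into one of the x ascent gaps replaces that ascent by an ascent, a plateau and a
-- descent; similarly for the y descent gaps and the z plateau gaps.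
grow : Weight → Weight
grow F x y z = x * F x (suc y) (suc z) + y * F (suc x) y (suc z) + z * F (suc x) (suc y) z

shiftBy : ℕ → ℕ → Weight → Weight
shiftBy p b F x y z = F (indicator (isAsc p b) + x) (indicator (isDes p b) + y) (indicator (isPlat p b) + z)

weigh-peak : ∀ F {p a b} l → p < a → b < a →
  weigh F p (a ∷ a ∷ b ∷ l) ≡ F (suc (countFrom isAsc b l)) (suc (countFrom isDes b l)) (suc (countFrom isPlat b l))
weigh-peak F {p} {a} {b} l p<a b<a
  rewrite ⌊⌋-true (p <? a) p<a | ⌊⌋-false (a <? a) (<-irrefl refl) | ⌊⌋-false (a <? b) (<-asym b<a)
        | ⌊⌋-false (a <? p) (<-asym p<a) | ⌊⌋-true (b <? a) b<a
        | ⌊⌋-false (p ≟ a) (<⇒≢ p<a) | ⌊⌋-true (a ≟ a) refl | ⌊⌋-false (a ≟ b) (>⇒≢ b<a) = refl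

grow-shiftBy : ∀ F p b x y z →
  F (suc x) (suc y) (suc z) + grow (shiftBy p b F) x y z
    ≡ grow F (indicator (isAsc p b) + x) (indicator (isDes p b) + y) (indicator (isPlat p b) + z)
grow-shiftBy F p b x y z with step p b
... | ascent  a d e rewrite a | d | e = ascent-case _ _ _ x y z
  where
  ascent-case : ∀ A B C x y z → A + (x * A + y * B + z * C) ≡ (A + x * A) + y * B + z * C
  ascent-case = solve-∀
... | descent a d e rewrite a | d | e = descent-case _ _ _ x y z
  where
  descent-case : ∀ A B C x y z → A + (x * B + y * A + z * C) ≡ x * B + (A + y * A) + z * C
  descent-case = solve-∀
... | plateau a d e rewrite a | d | e = plateau-case _ _ _ x y z
  where
  plateau-case : ∀ A B C x y z → A + (x * B + y * C + z * A) ≡ x * B + y * C + (A + z * A)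
  plateau-case = solve-∀

sum-insertions : ∀ F {a} p w → p < a → All (_< a) w →
  sum (map (λ c → weigh F p (c ++ 0 ∷ [])) (insertions a w)) ≡ weigh (grow F) p (w ++ 0 ∷ [])
sum-insertions F p [] p<a [] = trans (cong (_+ 0) (weigh-peak F [] p<a (≤-<-trans z≤n p<a))) (grow-shiftBy F p 0 0 0 0)
sum-insertions F {a} p (b ∷ w) p<a (b<a ∷ w<a) = begin
  weigh F p (a ∷ a ∷ b ∷ w ++ 0 ∷ []) + sum (map (λ c → weigh F p (c ++ 0 ∷ [])) (map (b ∷_) (insertions a w)))
    ≡⟨ cong₂ _+_ (weigh-peak F (w ++ 0 ∷ []) p<a b<a) (cong sum (sym (map-∘ (insertions a w)))) ⟩
  F (suc _) (suc _) (suc _) + sum (map (λ c → weigh (shiftBy p b F) b (c ++ 0 ∷ [])) (insertions a w))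
    ≡⟨ cong (_+_ (F _ _ _)) (sum-insertions (shiftBy p b F) b w b<a w<a) ⟩
  F (suc _) (suc _) (suc _) + weigh (grow (shiftBy p b F)) b (w ++ 0 ∷ [])
    ≡⟨ grow-shiftBy F p b _ _ _ ⟩
  weigh (grow F) p (b ∷ w ++ 0 ∷ []) ∎
  where open ≡-Reasoning

statistic : Weight → List ℕ → ℕ
statistic F w = F (ascents w) (descents w) (plateaux w)

total : Weight → List (List ℕ) → ℕ
total F L = sum (map (statistic F) L)

sum-map-concatMap : ∀ {A B : Set} (g : B → ℕ) (f : A → List B) xs →
  sum (map g (concatMap f xs)) ≡ sum (map (λ x → sum (map g (f x))) xs)
sum-map-concatMap g f [] = refl
sum-map-concatMap g f (x ∷ xs) = begin
  sum (map g (f x ++ concatMap f xs))           ≡⟨ cong sum (map-++ g (f x) _) ⟩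
  sum (map g (f x) ++ map g (concatMap f xs))   ≡⟨ sum-++ (map g (f x)) _ ⟩
  sum (map g (f x)) + sum (map g (concatMap f xs)) ≡⟨ cong (_+_ (sum (map g (f x)))) (sum-map-concatMap g f xs) ⟩
  sum (map g (f x)) + sum (map (λ x → sum (map g (f x))) xs) ∎
  where open ≡-Reasoning

total-insertions : ∀ F k L → All (All (_< suc k)) L →
  total F (concatMap (insertions (suc k)) L) ≡ total (grow F) L
total-insertions F k L L<a = trans (sum-map-concatMap (statistic F) (insertions (suc k)) L)
  (cong sum (map-cong-local (All.map (sum-insertions F 0 _ (s≤s z≤n)) L<a)))

total-cong : ∀ {F G : Weight} L → (∀ x y z → F x y z ≡ G x y z) → total F L ≡ total G L
total-cong L F≗G = cong sum (map-cong (λ w → F≗G _ _ _) L)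

total-+ : ∀ (F G : Weight) L → total (λ x y z → F x y z + G x y z) L ≡ total F L + total G L
total-+ F G [] = refl
total-+ F G (w ∷ L) = trans (cong (_+_ (statistic F w + statistic G w)) (total-+ F G L))
  (interchange (statistic F w) (statistic G w) (total F L) (total G L))

total-stirlings-suc : ∀ F k → total F (stirlings (suc k)) ≡ total (grow F) (stirlings k)
total-stirlings-suc F k = total-insertions F k (stirlings k) (All.tabulate (stirlings-< k))

-- The only Stirling permutation of order 1 is 1 1, whose statistics are (1, 1, 1).
total-relabel : (σ : Weight → Weight) → (∀ F → σ F 1 1 1 ≡ F 1 1 1) →
  (∀ F x y z → grow (σ F) x y z ≡ σ (grow F) x y z) →
  ∀ k F → total (σ F) (stirlings (suc k)) ≡ total F (stirlings (suc k))
total-relabel σ σ-base σ-grow zero F = cong (_+ 0) (σ-base F)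
total-relabel σ σ-base σ-grow (suc k) F = begin
  total (σ F) (stirlings (suc (suc k)))     ≡⟨ total-stirlings-suc (σ F) (suc k) ⟩
  total (grow (σ F)) (stirlings (suc k))    ≡⟨ total-cong (stirlings (suc k)) (σ-grow F) ⟩
  total (σ (grow F)) (stirlings (suc k))    ≡⟨ total-relabel σ σ-base σ-grow k (grow F) ⟩
  total (grow F) (stirlings (suc k))        ≡⟨ total-stirlings-suc F (suc k) ⟨
  total F (stirlings (suc (suc k)))         ∎
  where open ≡-Reasoning

swapAD swapDP : Weight → Weight
swapAD F x y z = F y x z
swapDP F x y z = F x z y

grow-swapAD : ∀ F x y z → grow (swapAD F) x y z ≡ swapAD (grow F) x y z
grow-swapAD F x y z = xy∙z≈yx∙z (x * F (suc y) x (suc z)) (y * F y (suc x) (suc z)) (z * F (suc y) (suc x) z)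

grow-swapDP : ∀ F x y z → grow (swapDP F) x y z ≡ swapDP (grow F) x y z
grow-swapDP F x y z = xy∙z≈xz∙y (x * F x (suc z) (suc y)) (y * F (suc x) (suc z) y) (z * F (suc x) z (suc y))

ascents+descents+plateaux : ∀ w → ascents w + descents w + plateaux w ≡ suc (length w)
ascents+descents+plateaux w = trans (steps-partition 0 (w ++ 0 ∷ [])) (trans (length-++ w) (+-comm (length w) 1))

total-steps-const : ∀ (H : Weight) s L → All (λ w → ascents w + descents w + plateaux w ≡ s) L →
  total (λ x y z → (x + y + z) * H x y z) L ≡ s * total H L
total-steps-const H s [] [] = sym (*-zeroʳ s)
total-steps-const H s (w ∷ L) (eq ∷ eqs) rewrite eq | total-steps-const H s L eqs =
  sym (*-distribˡ-+ s (statistic H w) (total H L))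

total-degree : ∀ k (H : Weight) → total (λ x y z → (x + y + z) * H x y z) (stirlings k) ≡ suc (k + k) * total H (stirlings k)
total-degree k H = total-steps-const H (suc (k + k)) (stirlings k)
  (All.tabulate λ {w} w∈ → trans (ascents+descents+plateaux w)
     (cong suc (trans (↭-length (IsStirling.isPerm (stirlings-sound k w∈))) (length-doubled k))))

total-one : ∀ L → total (λ _ _ _ → 1) L ≡ length L
total-one [] = refl
total-one (w ∷ L) = cong suc (total-one L)

recurrence : ∀ k (F K H E : Weight) → (∀ x y z → grow F x y z + K x y z ≡ (x + y + z) * H x y z + E x y z) →
  total F (stirlings (suc k)) + total K (stirlings k) ≡ suc (k + k) * total H (stirlings k) + total E (stirlings k)
recurrence k F K H E identity = begin
  total F (stirlings (suc k)) + total K L                     ≡⟨ cong (_+ total K L) (total-stirlings-suc F k) ⟩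
  total (grow F) L + total K L                                 ≡⟨ total-+ (grow F) K L ⟨
  total (λ x y z → grow F x y z + K x y z) L                   ≡⟨ total-cong L identity ⟩
  total (λ x y z → (x + y + z) * H x y z + E x y z) L          ≡⟨ total-+ (λ x y z → (x + y + z) * H x y z) E L ⟩
  total (λ x y z → (x + y + z) * H x y z) L + total E L        ≡⟨ cong (_+ total E L) (total-degree k H) ⟩
  suc (k + k) * total H L + total E L                          ∎
  where
  open ≡-Reasoning
  L = stirlings k

total-swapAD : ∀ m F → total (swapAD F) (stirlings (suc m)) ≡ total F (stirlings (suc m))
total-swapAD = total-relabel swapAD (λ _ → refl) grow-swapAD

total-swapDP : ∀ m F → total (swapDP F) (stirlings (suc m)) ≡ total F (stirlings (suc m))
total-swapDP = total-relabel swapDP (λ _ → refl) grow-swapDP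

sumAsc sumAscDes : ℕ → ℕ
sumAsc k = total (λ x _ _ → x) (stirlings k)
sumAscDes k = total (λ x y _ → x * y) (stirlings k)

sumDes≡sumAsc : ∀ m → total (λ _ y _ → y) (stirlings (suc m)) ≡ sumAsc (suc m)
sumDes≡sumAsc m = total-swapAD m (λ x _ _ → x)

sumPlat≡sumAsc : ∀ m → total (λ _ _ z → z) (stirlings (suc m)) ≡ sumAsc (suc m)
sumPlat≡sumAsc m = trans (total-swapDP m (λ _ y _ → y)) (sumDes≡sumAsc m)

sumAscPlat≡sumAscDes : ∀ m → total (λ x _ z → x * z) (stirlings (suc m)) ≡ sumAscDes (suc m)
sumAscPlat≡sumAscDes m = total-swapDP m (λ x y _ → x * y)

sumDesPlat≡sumAscDes : ∀ m → total (λ _ y z → y * z) (stirlings (suc m)) ≡ sumAscDes (suc m)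
sumDesPlat≡sumAscDes m = trans (total-swapAD m (λ x _ z → x * z)) (sumAscPlat≡sumAscDes m)

sumAsc-closed : ∀ m → 3 * sumAsc (suc m) ≡ suc (suc m + suc m) * length (stirlings (suc m))
sumAsc-closed m = begin
  3 * A                                                ≡⟨ cong (λ t → A + (A + t)) (+-identityʳ A) ⟩
  A + (A + A)                                          ≡⟨ +-assoc A A A ⟨
  A + A + A                                            ≡⟨ cong₂ (λ b c → A + b + c) (sumDes≡sumAsc m) (sumPlat≡sumAsc m) ⟨
  total (λ x _ _ → x) L + total (λ _ y _ → y) L + total (λ _ _ z → z) L
    ≡⟨ cong (_+ total (λ _ _ z → z) L) (total-+ (λ x _ _ → x) (λ _ y _ → y) L) ⟨
  total (λ x y _ → x + y) L + total (λ _ _ z → z) L  ≡⟨ total-+ (λ x y _ → x + y) (λ _ _ z → z) L ⟨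
  total (λ x y z → x + y + z) L                        ≡⟨ total-cong L (λ x y z → *-identityʳ (x + y + z)) ⟨
  total (λ x y z → (x + y + z) * 1) L                  ≡⟨ total-degree (suc m) (λ _ _ _ → 1) ⟩
  suc (suc m + suc m) * total (λ _ _ _ → 1) L          ≡⟨ cong (suc (suc m + suc m) *_) (total-one L) ⟩
  suc (suc m + suc m) * length L                       ∎
  where
  open ≡-Reasoning
  L = stirlings (suc m)
  A = sumAsc (suc m)

sumAscDes-recurrence : ∀ m → let k = suc m; g = suc (k + k) in
  sumAscDes (suc k) + (sumAscDes k + sumAscDes k) ≡ g * (sumAscDes k + sumAsc k + sumAsc k) + sumAsc k
sumAscDes-recurrence m = begin
  sumAscDes (suc k) + (P + P)                                   ≡⟨ cong (_+_ (sumAscDes (suc k))) (total-+ xy xy L) ⟨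
  sumAscDes (suc k) + total (λ x y z → xy x y z + xy x y z) L
    ≡⟨ recurrence k xy (λ x y z → xy x y z + xy x y z) (λ x y _ → x * y + x + y) (λ _ _ z → z) identity ⟩
  g * total (λ x y _ → x * y + x + y) L + total (λ _ _ z → z) L
    ≡⟨ cong₂ (λ s t → g * s + t)
         (trans (total-+ (λ x y _ → x * y + x) (λ _ y _ → y) L)
                (cong₂ _+_ (total-+ xy (λ x _ _ → x) L) (sumDes≡sumAsc m)))
         (sumPlat≡sumAsc m) ⟩
  g * (P + sumAsc k + sumAsc k) + sumAsc k                      ∎
  where
  open ≡-Reasoning
  k = suc m
  g = suc (k + k)
  L = stirlings k
  P = sumAscDes k
  xy : Weight
  xy x y _ = x * y
  identity : ∀ x y z → x * (x * suc y) + y * (suc x * y) + z * (suc x * suc y) + (x * y + x * y)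
                       ≡ (x + y + z) * (x * y + x + y) + z
  identity = solve-∀

-- 9 (2n − 1) E[ascents · descents] for n = m + 1, i.e. n (8n² + 3n − 2).
scaledMeanAscDes : ℕ → ℕ
scaledMeanAscDes m = (m + 1) * (8 * m * m + 19 * m + 9)

sumAscDes-closed-step : ∀ m N A P P' → let g = suc (suc m + suc m) in
  3 * A ≡ g * N → 9 * suc (m + m) * P ≡ scaledMeanAscDes m * N → P' + (P + P) ≡ g * (P + A + A) + A →
  9 * g * P' ≡ scaledMeanAscDes (suc m) * (g * N)
sumAscDes-closed-step m N A P P' 3A≡gN closed rec = +-cancelʳ-≡ (T * (P + P)) _ _ (begin
  T * P' + T * (P + P)                                                 ≡⟨ *-distribˡ-+ T P' (P + P) ⟨
  T * (P' + (P + P))                                                   ≡⟨ cong (T *_) rec ⟩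
  T * (g * (P + A + A) + A)                                            ≡⟨ expand m P A ⟩
  g * (9 * suc (m + m) * P) + T * (P + P) + 3 * g * (2 * g + 1) * (3 * A)
    ≡⟨ cong₂ (λ s t → g * s + T * (P + P) + 3 * g * (2 * g + 1) * t) closed 3A≡gN ⟩
  g * (scaledMeanAscDes m * N) + T * (P + P) + 3 * g * (2 * g + 1) * (g * N) ≡⟨ collect m N P ⟩
  scaledMeanAscDes (suc m) * (g * N) + T * (P + P)                    ∎)
  where
  open ≡-Reasoning
  g = suc (suc m + suc m)
  T = 9 * g
  expand : ∀ m P A → let g = suc (suc m + suc m) in
    9 * g * (g * (P + A + A) + A) ≡ g * (9 * suc (m + m) * P) + 9 * g * (P + P) + 3 * g * (2 * g + 1) * (3 * A)
  expand = solve-∀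
  collect : ∀ m N P → let g = suc (suc m + suc m) in
    g * ((m + 1) * (8 * m * m + 19 * m + 9) * N) + 9 * g * (P + P) + 3 * g * (2 * g + 1) * (g * N)
      ≡ (suc m + 1) * (8 * suc m * suc m + 19 * suc m + 9) * (g * N) + 9 * g * (P + P)
  collect = solve-∀

length-stirlings-suc : ∀ k → length (stirlings (suc k)) ≡ suc (k + k) * length (stirlings k)
length-stirlings-suc k = begin
  length (stirlings (suc k))                          ≡⟨ total-one (stirlings (suc k)) ⟨
  total (λ _ _ _ → 1) (stirlings (suc k))             ≡⟨ total-stirlings-suc (λ _ _ _ → 1) k ⟩
  total (grow (λ _ _ _ → 1)) (stirlings k)            ≡⟨ total-cong (stirlings k) factor ⟩
  total (λ x y z → (x + y + z) * 1) (stirlings k)     ≡⟨ total-degree k (λ _ _ _ → 1) ⟩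
  suc (k + k) * total (λ _ _ _ → 1) (stirlings k)     ≡⟨ cong (suc (k + k) *_) (total-one (stirlings k)) ⟩
  suc (k + k) * length (stirlings k)                  ∎
  where
  open ≡-Reasoning
  factor : ∀ x y z → x * 1 + y * 1 + z * 1 ≡ (x + y + z) * 1
  factor = solve-∀

length-stirlings-nonzero : ∀ k → ∃ λ N' → length (stirlings k) ≡ suc N'
length-stirlings-nonzero zero = 0 , refl
length-stirlings-nonzero (suc k) with length-stirlings-nonzero k
... | N' , eq = _ , trans (length-stirlings-suc k) (cong (suc (k + k) *_) eq)

sumAscDes-closed : ∀ m → 9 * suc (m + m) * sumAscDes (suc m) ≡ scaledMeanAscDes m * length (stirlings (suc m))
sumAscDes-closed zero = refl
sumAscDes-closed (suc m) =
  trans (sumAscDes-closed-step m (length (stirlings (suc m))) (sumAsc (suc m)) (sumAscDes (suc m)) (sumAscDes (suc (suc m)))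
           (sumAsc-closed m) (sumAscDes-closed m) (sumAscDes-recurrence m))
        (cong (scaledMeanAscDes (suc m) *_) (sym (length-stirlings-suc (suc m))))

variance-identity : ∀ (p a n d e q k : ℤ) →
  + 3 ℤ.* a ≡ e ℤ.* n → d ℤ.* p ≡ q ℤ.* n → d ℤ.* (e ℤ.* e) ≡ + 9 ℤ.* q ℤ.+ + 9 ℤ.* k →
  (p ℤ.* (n ℤ.* n) ℤ.+ - (a ℤ.* a) ℤ.* n) ℤ.* d ≡ - k ℤ.* (n ℤ.* (n ℤ.* n))
variance-identity p a n d e q k 3a≡en dp≡qn de²≡9q+9k = ℤ.*-cancelˡ-≡ (+ 9) _ _ (begin
  + 9 ℤ.* ((p ℤ.* (n ℤ.* n) ℤ.+ - (a ℤ.* a) ℤ.* n) ℤ.* d)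
    ≡⟨ expand p a n d ⟩
  + 9 ℤ.* (n ℤ.* n) ℤ.* (d ℤ.* p) ℤ.- d ℤ.* n ℤ.* ((+ 3 ℤ.* a) ℤ.* (+ 3 ℤ.* a))
    ≡⟨ cong₂ (λ s t → + 9 ℤ.* (n ℤ.* n) ℤ.* s ℤ.- d ℤ.* n ℤ.* (t ℤ.* t)) dp≡qn 3a≡en ⟩
  + 9 ℤ.* (n ℤ.* n) ℤ.* (q ℤ.* n) ℤ.- d ℤ.* n ℤ.* ((e ℤ.* n) ℤ.* (e ℤ.* n))
    ≡⟨ regroup n d e q ⟩
  n³ ℤ.* (+ 9 ℤ.* q) ℤ.- n³ ℤ.* (d ℤ.* (e ℤ.* e))
    ≡⟨ cong (λ t → n³ ℤ.* (+ 9 ℤ.* q) ℤ.- n³ ℤ.* t) de²≡9q+9k ⟩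
  n³ ℤ.* (+ 9 ℤ.* q) ℤ.- n³ ℤ.* (+ 9 ℤ.* q ℤ.+ + 9 ℤ.* k)
    ≡⟨ cancel n q k ⟩
  + 9 ℤ.* (- k ℤ.* n³) ∎)
  where
  open ≡-Reasoning
  n³ = n ℤ.* (n ℤ.* n)
  expand : ∀ p a n d → + 9 ℤ.* ((p ℤ.* (n ℤ.* n) ℤ.+ - (a ℤ.* a) ℤ.* n) ℤ.* d)
                       ≡ + 9 ℤ.* (n ℤ.* n) ℤ.* (d ℤ.* p) ℤ.- d ℤ.* n ℤ.* ((+ 3 ℤ.* a) ℤ.* (+ 3 ℤ.* a))
  expand = ℤ-Solver.solve-∀
  regroup : ∀ n d e q → + 9 ℤ.* (n ℤ.* n) ℤ.* (q ℤ.* n) ℤ.- d ℤ.* n ℤ.* ((e ℤ.* n) ℤ.* (e ℤ.* n))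
                        ≡ n ℤ.* (n ℤ.* n) ℤ.* (+ 9 ℤ.* q) ℤ.- n ℤ.* (n ℤ.* n) ℤ.* (d ℤ.* (e ℤ.* e))
  regroup = ℤ-Solver.solve-∀
  cancel : ∀ n q k → n ℤ.* (n ℤ.* n) ℤ.* (+ 9 ℤ.* q) ℤ.- n ℤ.* (n ℤ.* n) ℤ.* (+ 9 ℤ.* q ℤ.+ + 9 ℤ.* k)
                     ≡ + 9 ℤ.* (- k ℤ.* (n ℤ.* (n ℤ.* n)))
  cancel = ℤ-Solver.solve-∀

pos-*-≡ : ∀ a b c d → a * b ≡ c * d → + a ℤ.* + b ≡ + c ℤ.* + d
pos-*-≡ a b c d eq = trans (sym (ℤ.pos-* a b)) (trans (cong +_ eq) (ℤ.pos-* c d))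

module _ (m N' A P : ℕ) where
  private
    N = suc N'
    D = 9 * suc (m + m)
    E = suc (suc m + suc m)
    Q = scaledMeanAscDes m
    K = suc m * suc m ∸ 1    -- reduces to m + m * suc m

  covariance-ℚᵘ : 3 * A ≡ E * N → D * P ≡ Q * N →
    mkℚᵘ (+ P) N' ℚᵘ.- mkℚᵘ (+ A) N' ℚᵘ.* mkℚᵘ (+ A) N' ℚᵘ.≃ ℚᵘ.- mkℚᵘ (+ K) (pred D)
  covariance-ℚᵘ 3A≡EN DP≡QN = *≡* (subst₂
      (λ n² n³ → (+ P ℤ.* n² ℤ.+ - (+ A ℤ.* + A) ℤ.* + N) ℤ.* + D ≡ - (+ K) ℤ.* n³)
      (sym (ℤ.pos-* N N)) (sym (trans (ℤ.pos-* N (N * N)) (cong (+ N ℤ.*_) (ℤ.pos-* N N))))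
      (variance-identity (+ P) (+ A) (+ N) (+ D) (+ E) (+ Q) (+ K) (pos-*-≡ 3 A E N 3A≡EN) (pos-*-≡ D P Q N DP≡QN) DE²≡9Q+9K))
    where
    DE²≡9Q+9K : + D ℤ.* (+ E ℤ.* + E) ≡ + 9 ℤ.* + Q ℤ.+ + 9 ℤ.* + K
    DE²≡9Q+9K = begin
      + D ℤ.* (+ E ℤ.* + E)          ≡⟨ cong (+ D ℤ.*_) (ℤ.pos-* E E) ⟨
      + D ℤ.* + (E * E)              ≡⟨ ℤ.pos-* D (E * E) ⟨
      + (D * (E * E))                ≡⟨ cong +_ (arithmetic m) ⟩
      + (9 * Q + 9 * K)              ≡⟨ ℤ.pos-+ (9 * Q) (9 * K) ⟩
      + (9 * Q) ℤ.+ + (9 * K)        ≡⟨ cong₂ ℤ._+_ (ℤ.pos-* 9 Q) (ℤ.pos-* 9 K) ⟩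
      + 9 ℤ.* + Q ℤ.+ + 9 ℤ.* + K    ∎
      where
      open ≡-Reasoning
      arithmetic : ∀ m → 9 * suc (m + m) * (suc (suc m + suc m) * suc (suc m + suc m))
                         ≡ 9 * ((m + 1) * (8 * m * m + 19 * m + 9)) + 9 * (m + m * suc m)
      arithmetic = solve-∀

  covariance-ℚ : 3 * A ≡ E * N → D * P ≡ Q * N →
    (+ P / N) ℚ.- ((+ A / N) ℚ.* (+ A / N)) ≡ covValue (suc m)
  covariance-ℚ 3A≡EN DP≡QN = toℚᵘ-injective (begin
    toℚᵘ (p ℚ.- a ℚ.* a)                          ≈⟨ toℚᵘ-homo-+ p (ℚ.- (a ℚ.* a)) ⟩
    toℚᵘ p ℚᵘ.+ toℚᵘ (ℚ.- (a ℚ.* a))             ≈⟨ ℚᵘ.+-congʳ (toℚᵘ p) (toℚᵘ-homo‿- (a ℚ.* a)) ⟩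
    toℚᵘ p ℚᵘ.- toℚᵘ (a ℚ.* a)                   ≈⟨ ℚᵘ.+-congʳ (toℚᵘ p) (ℚᵘ.-‿cong (toℚᵘ-homo-* a a)) ⟩
    toℚᵘ p ℚᵘ.- toℚᵘ a ℚᵘ.* toℚᵘ a               ≈⟨ ℚᵘ.+-cong (toℚᵘ-fromℚᵘ (mkℚᵘ (+ P) N'))
                                                      (ℚᵘ.-‿cong (ℚᵘ.*-cong (toℚᵘ-fromℚᵘ (mkℚᵘ (+ A) N')) (toℚᵘ-fromℚᵘ (mkℚᵘ (+ A) N')))) ⟩
    mkℚᵘ (+ P) N' ℚᵘ.- mkℚᵘ (+ A) N' ℚᵘ.* mkℚᵘ (+ A) N'  ≈⟨ covariance-ℚᵘ 3A≡EN DP≡QN ⟩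
    ℚᵘ.- mkℚᵘ (+ K) (pred D)                     ≈⟨ ℚᵘ.-‿cong (ℚᵘ.≃-sym (toℚᵘ-fromℚᵘ (mkℚᵘ (+ K) (pred D)))) ⟩
    ℚᵘ.- toℚᵘ (+ K / D)                          ≈⟨ ℚᵘ.≃-sym (toℚᵘ-homo‿- (+ K / D)) ⟩
    toℚᵘ (covValue (suc m))                     ∎)
    where
    open ℚᵘ.≃-Reasoning
    p = + P / N
    a = + A / N

Cov-from-sums : ∀ {A : Set} (L : List A) (f g : A → ℕ) {N' a b p} → length L ≡ suc N' →
  sum (map f L) ≡ a → sum (map g L) ≡ b → sum (map (λ x → f x * g x) L) ≡ p →
  Cov L f g ≡ (+ p / suc N') ℚ.- ((+ a / suc N') ℚ.* (+ b / suc N'))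
Cov-from-sums (_ ∷ _) f g refl refl refl refl = refl

Cov-stirlings : ∀ m {L} → L ↭ stirlings (suc m) → ∀ (f g : List ℕ → ℕ) →
  sum (map f (stirlings (suc m))) ≡ sumAsc (suc m) → sum (map g (stirlings (suc m))) ≡ sumAsc (suc m) →
  sum (map (λ w → f w * g w) (stirlings (suc m))) ≡ sumAscDes (suc m) →
  Cov L f g ≡ covValue (suc m)
Cov-stirlings m {L} L↭S f g Σf Σg Σfg with length-stirlings-nonzero (suc m)
... | N' , |S|≡N = trans
  (Cov-from-sums L f g (trans (↭-length L↭S) |S|≡N) (trans (sum-↭-stirlings f) Σf) (trans (sum-↭-stirlings g) Σg)
     (trans (sum-↭-stirlings _) Σfg))
  (covariance-ℚ m N' (sumAsc (suc m)) (sumAscDes (suc m))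
     (trans (sumAsc-closed m) (cong (suc (suc m + suc m) *_) |S|≡N))
     (trans (sumAscDes-closed m) (cong (scaledMeanAscDes m *_) |S|≡N)))
  where
  sum-↭-stirlings : ∀ h → sum (map h L) ≡ sum (map h (stirlings (suc m)))
  sum-↭-stirlings h = sum-↭ (↭.map⁺ h L↭S)

theorem2p4 : (m : ℕ) → (L : List (List ℕ)) → Unique L →
               (∀ w → w ∈ L ⇔ IsStirling (suc m) w) →
               (Cov L ascents descents ≡ covValue (suc m))
               × (Cov L ascents plateaux ≡ covValue (suc m))
               × (Cov L descents plateaux ≡ covValue (suc m))
theorem2p4 m L L! L⇔ =
    Cov-stirlings m L↭S ascents descents refl (sumDes≡sumAsc m) refl
  , Cov-stirlings m L↭S ascents plateaux refl (sumPlat≡sumAsc m) (sumAscPlat≡sumAscDes m)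
  , Cov-stirlings m L↭S descents plateaux (sumDes≡sumAsc m) (sumPlat≡sumAsc m) (sumDesPlat≡sumAscDes m)
  where
  L↭S : L ↭ stirlings (suc m)
  L↭S = ↭-stirlings (suc m) L! L⇔
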